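{- There is an operator $\mathcal{E}$ on derivations in $\mathrm{BI}^\Omega$ such that for every derivation $d$ of $\mathrm{BI}^\Omega$: (1) for every natural number $m$ and sequent $\Gamma$, if $d\vdash_{m+1}\Gamma$ then $\mathcal{E}(d)\vdash_m\Gamma$; (2) $\Gamma(\mathcal{E}(d))=\Gamma(d)$.
   Context: Language $L$: terms are built from $0$ by successor $S$; atomic formulas are $R(t_1,\dots,t_n)$ ($R$ a symbol for an $n$-ary primitive recursive relation) and $X(t)$ ($X$ a unary set variable); literals are atomic formulas and their negations. Formulas are built from literals by $\wedge,\vee$, number quantifiers ($\forall xA(x),\exists xA(x)$ are formulas when $A(0)$ is; formulas have no free number variables) and $\forall XA,\exists XA$, allowed only when $A$ has no second-order quantifier and no free set variable other than $X$. Negation of non-atomic formulas is by De Morgan's laws. TRUE is the set of true closed literals $R(\vec n)$, $\neg R(\vec n)$. Rank: $rk(A)=0$ if $A$ is a literal or of the form $\forall XA(X)$ or $\exists XA(X)$; $rk(A\wedge B)=rk(A\vee B)=\max(rk(A),rk(B))+1$; $rk(\forall xA(x))=rk(\exists xA(x))=rk(A(0))+1$. A $\Pi^1$-formula has no subformula of the form $\exists XA(X)$; a $\Pi^1$-sequent is a finite set of $\Pi^1$-formulas. Sequents are finite sets; $\Gamma,A=\Gamma\cup\{A\}$. Derivations: each inference symbol $I$ has principal formulas $\Delta(I)$, index set $|I|$, minor formulas $\Delta_i(I)$ ($i\in|I|$). A derivation $d=I(d_i)_{i\in|I|}$ is a well-founded (possibly infinitely branching) labelled tree with end-sequent $\Gamma(d)$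 such that $\Delta(I)\subseteq\Gamma(d)$ and $\Gamma(d_i)\subseteq\Gamma(d)\cup\Delta_i(I)$ for all $i$; eigenvariables do not occur free in the conclusion of their inference. $\mathrm{BI}^\Omega_0$ has the rules: $\mathrm{Ax}_\Delta$ (no premises) with $\Delta=\{A\}\subseteq$ TRUE or $\Delta=\{C,\neg C\}$; $\bigwedge_{A_0\wedge A_1}$ (premises $A_0$, $A_1$); $\bigvee^k_{A_0\vee A_1}$, $k\in\{0,1\}$ (premise $A_k$); $\bigwedge_{\forall xA}$ (premises $A(\bar n)$ for all $n\in\omega$); $\bigvee^k_{\exists xA}$, $k\in\omega$ (premise $A(\bar k)$); $\bigwedge_{\forall XA}$ (premise $A(X/Y)$, $Y$ an eigenvariable); $\mathrm{Cut}_A$ ($\Delta=\emptyset$, premises with minor formulas $A$ and $\neg A$); $\mathrm{Rep}$ ($\Delta=\emptyset$, one premise with no minor formula). In each case the principal formula is the displayed conclusion formula. $\mathrm{BI}^\Omega$ adds two rules. Let $|\forall XA(X)|$ be the set of pairs $q=(e,Z)$ where $e$ is a derivation in $\mathrm{BI}^\Omega_0$ containing no Cut, $\Gamma(e)$ is a $\Pi^1$-sequent, $Z$ is a set variable, and $Z$ is not free in $\Delta_q:=\Gamma(e)\setminus\{A(Z)\}$. Rule $\Omega_{\neg\forall XA}$: $\Delta=\{\neg\forall XA\}$, index set $|\forall XA(X)|$, minor formulas $\Delta_q$ for premise $q$. Rule $\widetilde\Omega^Y_{\neg\forall XA}$: $\Delta=\emptyset$, index set $\{0\}\cup|\forall XA(X)|$,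 minor formulas $\{A(Y)\}$ for premise $0$ ($Y$ an eigenvariable) and $\Delta_q$ for premise $q$. Cut-degree: $dg(\mathrm{Cut}_C)=rk(C)+1$, $dg(I)=0$ for all other inference symbols (including $\widetilde\Omega$); $dg(I(d_i)_{i\in|I|})=\sup(\{dg(I)\}\cup\{dg(d_i):i\in|I|\})$. We write $d\vdash_m\Gamma$ if $\Gamma(d)=\Gamma$ and $dg(d)\le m$. -}

module Defs where

open import Data.Nat using (ℕ; zero; suc; _⊔_; _≤_; _+_)
open import Data.Fin using (Fin; zero; suc)
open import Data.Vec using (Vec; []; _∷_)
open import Data.Bool using (Bool; true; false)
open import Data.Unit using (⊤; tt)
open import Data.Empty using (⊥)
open import Data.Product using (Σ; _×_; _,_; proj₁; proj₂)
open import Data.Sum using (_⊎_)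
open import Data.List using (List)
open import Data.List.Membership.Propositional using (_∈_)
open import Relation.Binary.PropositionalEquality using (_≡_)
open import Relation.Nullary using (¬_)

-- Primitive recursive functions (codes) and their semantics.
-- A relation symbol of arity k is a code f : PR k; it denotes the
-- primitive recursive relation { ns | eval f ns ≠ 0 }.

data PR : ℕ → Set where
  Zero : PR 0
  Succ : PR 1
  Proj : ∀ {k} → Fin k → PR k
  Comp : ∀ {k l} → PR l → Vec (PR k) l → PR k
  Rec  : ∀ {k} → PR k → PR (suc (suc k)) → PR (suc k)

lookupV : ∀ {k} → Vec ℕ k → Fin k → ℕ
lookupV (x ∷ xs) zero    = x
lookupV (x ∷ xs) (suc i) = lookupV xs i

mutual
  evalPR : ∀ {k} → PR k → Vec ℕ k → ℕ
  evalPR Zero       _  = 0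
  evalPR Succ (x ∷ []) = suc x
  evalPR (Proj i)   xs = lookupV xs i
  evalPR (Comp f gs) xs = evalPR f (evalPRs gs xs)
  evalPR (Rec g h) (n ∷ xs) = evalRec g h n xs

  evalPRs : ∀ {k l} → Vec (PR k) l → Vec ℕ k → Vec ℕ l
  evalPRs []       xs = []
  evalPRs (g ∷ gs) xs = evalPR g xs ∷ evalPRs gs xs

  evalRec : ∀ {k} → PR k → PR (suc (suc k)) → ℕ → Vec ℕ k → ℕ
  evalRec g h zero    xs = evalPR g xs
  evalRec g h (suc n) xs = evalPR h (n ∷ evalRec g h n xs ∷ xs)

RelHolds : ∀ {k} → PR k → Vec ℕ k → Set
RelHolds f ns = ¬ (evalPR f ns ≡ 0)

-- Terms, with number variables as de Bruijn indices (n bound in scope).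

data Term (n : ℕ) : Set where
  var  : Fin n → Term n
  zro  : Term n
  S    : Term n → Term n

numeral : ∀ {n} → ℕ → Term n
numeral zero    = zro
numeral (suc k) = S (numeral k)

renT : ∀ {n m} → (Fin n → Fin m) → Term n → Term m
renT ρ (var i) = var (ρ i)
renT ρ zro     = zro
renT ρ (S t)   = S (renT ρ t)

subT : ∀ {n m} → (Fin n → Term m) → Term n → Term m
subT σ (var i) = σ i
subT σ zro     = zro
subT σ (S t)   = S (subT σ t)

mapV : ∀ {A B : Set} {k} → (A → B) → Vec A k → Vec B k
mapV f []       = []
mapV f (x ∷ xs) = f x ∷ mapV f xs

evalT : Term 0 → ℕ
evalT (var ())
evalT zro   = 0
evalT (S t) = suc (evalT t)

-- Index b : Bool.
--   b = true : formulas of L, whose free set variables are (eigen)variables Y : ℕ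
--              and which may contain second-order quantifiers;
--   b = false: bodies A(X) of second-order quantifiers ∀X A / ∃X A: no
--              second-order quantifier, and the only set variable is X (tt : ⊤).
-- Index n: number of bound number variables in scope (formulas proper have n = 0;
-- ∀x A(x) has body A : Fm b (suc n), and A(t) is obtained by substitution).

SA : Bool → Set
SA true  = ℕ
SA false = ⊤

data Fm : Bool → ℕ → Set where
  rel   : ∀ {b n k} → PR k → Vec (Term n) k → Fm b n
  nrel  : ∀ {b n k} → PR k → Vec (Term n) k → Fm b n
  mem   : ∀ {b n} → SA b → Term n → Fm b n
  nmem  : ∀ {b n} → SA b → Term n → Fm b n
  _∧'_  : ∀ {b n} → Fm b n → Fm b n → Fm b n
  _∨'_  : ∀ {b n} → Fm b n → Fm b n → Fm b n
  all1  : ∀ {b n} → Fm b (suc n) → Fm b n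
  ex1   : ∀ {b n} → Fm b (suc n) → Fm b n
  all2  : ∀ {n} → Fm false n → Fm true n
  ex2   : ∀ {n} → Fm false n → Fm true n

Formula : Set
Formula = Fm true 0

neg : ∀ {b n} → Fm b n → Fm b n
neg (rel f ts)  = nrel f ts
neg (nrel f ts) = rel f ts
neg (mem X t)   = nmem X t
neg (nmem X t)  = mem X t
neg (A ∧' B)    = neg A ∨' neg B
neg (A ∨' B)    = neg A ∧' neg B
neg (all1 A)    = ex1 (neg A)
neg (ex1 A)     = all1 (neg A)
neg (all2 A)    = ex2 (neg A)
neg (ex2 A)     = all2 (neg A)

liftσ : ∀ {n m} → (Fin n → Term m) → Fin (suc n) → Term (suc m)
liftσ σ zero    = var zero
liftσ σ (suc i) = renT suc (σ i)

subF : ∀ {b n m} → (Fin n → Term m) → Fm b n → Fm b m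
subF σ (rel f ts)  = rel f (mapV (subT σ) ts)
subF σ (nrel f ts) = nrel f (mapV (subT σ) ts)
subF σ (mem X t)   = mem X (subT σ t)
subF σ (nmem X t)  = nmem X (subT σ t)
subF σ (A ∧' B)    = subF σ A ∧' subF σ B
subF σ (A ∨' B)    = subF σ A ∨' subF σ B
subF σ (all1 A)    = all1 (subF (liftσ σ) A)
subF σ (ex1 A)     = ex1 (subF (liftσ σ) A)
subF σ (all2 A)    = all2 (subF σ A)
subF σ (ex2 A)     = ex2 (subF σ A)

instσ : ∀ {n} → ℕ → Fin (suc n) → Term n
instσ k zero    = numeral k
instσ k (suc i) = var i

inst : ∀ {b n} → Fm b (suc n) → ℕ → Fm b n
inst A k = subF (instσ k) A

plug : ∀ {n} → Fm false n → ℕ → Fm true n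
plug (rel f ts)  Y = rel f ts
plug (nrel f ts) Y = nrel f ts
plug (mem _ t)   Y = mem Y t
plug (nmem _ t)  Y = nmem Y t
plug (A ∧' B)    Y = plug A Y ∧' plug B Y
plug (A ∨' B)    Y = plug A Y ∨' plug B Y
plug (all1 A)    Y = all1 (plug A Y)
plug (ex1 A)     Y = ex1 (plug A Y)

-- rank.  rk(∀x A(x)) = rk(A(0)) + 1; since substitution does not change
-- the rank we compute it on the body directly.
rk : ∀ {b n} → Fm b n → ℕ
rk (rel f ts)  = 0
rk (nrel f ts) = 0
rk (mem X t)   = 0
rk (nmem X t)  = 0
rk (A ∧' B)    = suc (rk A ⊔ rk B)
rk (A ∨' B)    = suc (rk A ⊔ rk B)
rk (all1 A)    = suc (rk A)
rk (ex1 A)     = suc (rk A)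
rk (all2 A)    = 0
rk (ex2 A)     = 0

Occurs : ∀ {n} → ℕ → Fm true n → Set
Occurs Y (rel f ts)  = ⊥
Occurs Y (nrel f ts) = ⊥
Occurs Y (mem Z t)   = Y ≡ Z
Occurs Y (nmem Z t)  = Y ≡ Z
Occurs Y (A ∧' B)    = Occurs Y A ⊎ Occurs Y B
Occurs Y (A ∨' B)    = Occurs Y A ⊎ Occurs Y B
Occurs Y (all1 A)    = Occurs Y A
Occurs Y (ex1 A)     = Occurs Y A
Occurs Y (all2 A)    = ⊥
Occurs Y (ex2 A)     = ⊥

Pi1 : ∀ {b n} → Fm b n → Set
Pi1 (rel f ts)  = ⊤
Pi1 (nrel f ts) = ⊤
Pi1 (mem X t)   = ⊤
Pi1 (nmem X t)  = ⊤
Pi1 (A ∧' B)    = Pi1 A × Pi1 B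
Pi1 (A ∨' B)    = Pi1 A × Pi1 B
Pi1 (all1 A)    = Pi1 A
Pi1 (ex1 A)     = Pi1 A
Pi1 (all2 A)    = Pi1 A
Pi1 (ex2 A)     = ⊥

TRUE : Formula → Set
TRUE (rel f ts)  = RelHolds f (mapV evalT ts)
TRUE (nrel f ts) = ¬ RelHolds f (mapV evalT ts)
TRUE _           = ⊥

-- Sequents: finite sets of formulas, represented by lists read as sets
-- (membership _∈_ and set equality _≈ₛ_).

Sequent : Set
Sequent = List Formula

_≈ₛ_ : Sequent → Sequent → Set
Γ ≈ₛ Δ = (∀ {F} → F ∈ Γ → F ∈ Δ) × (∀ {F} → F ∈ Δ → F ∈ Γ)

Pi1Seq : Sequent → Set
Pi1Seq Γ = ∀ {F} → F ∈ Γ → Pi1 F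

NotFreeIn : ℕ → Sequent → Set
NotFreeIn Y Γ = ∀ {F} → F ∈ Γ → ¬ Occurs Y F

_∪₁_ : Sequent → Formula → Formula → Set
(Γ ∪₁ A) F = F ∈ Γ ⊎ F ≡ A

pick : ∀ {b n} → Fin 2 → Fm b n → Fm b n → Fm b n
pick zero          A₀ A₁ = A₀
pick (suc zero)    A₀ A₁ = A₁

-- Derivations of BI^Ω_0, indexed by their end-sequent Γ(d).
-- A premise with allowed context P (= Γ(d) ∪ Δᵢ(I)) is a derivation
-- dᵢ together with a proof of Γ(dᵢ) ⊆ P.

data D0 : Sequent → Set

record Prem0 (P : Formula → Set) : Set where
  inductive
  constructor prem0
  field
    Γ'  : Sequent
    der : D0 Γ'
    sub : ∀ {F} → F ∈ Γ' → P F

data D0 where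
  axT   : ∀ {Γ} (A : Formula) → TRUE A → A ∈ Γ → D0 Γ
  axC   : ∀ {Γ} (C : Formula) → C ∈ Γ → neg C ∈ Γ → D0 Γ
  andR  : ∀ {Γ} (A₀ A₁ : Formula) → (A₀ ∧' A₁) ∈ Γ →
          Prem0 (Γ ∪₁ A₀) → Prem0 (Γ ∪₁ A₁) → D0 Γ
  orR   : ∀ {Γ} (A₀ A₁ : Formula) (k : Fin 2) → (A₀ ∨' A₁) ∈ Γ →
          Prem0 (Γ ∪₁ pick k A₀ A₁) → D0 Γ
  allR  : ∀ {Γ} (A : Fm true 1) → all1 A ∈ Γ →
          ((n : ℕ) → Prem0 (Γ ∪₁ inst A n)) → D0 Γ
  exR   : ∀ {Γ} (A : Fm true 1) (k : ℕ) → ex1 A ∈ Γ →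
          Prem0 (Γ ∪₁ inst A k) → D0 Γ
  all2R : ∀ {Γ} (A : Fm false 0) (Y : ℕ) → all2 A ∈ Γ → NotFreeIn Y Γ →
          Prem0 (Γ ∪₁ plug A Y) → D0 Γ
  cut   : ∀ {Γ} (C : Formula) → Prem0 (Γ ∪₁ C) → Prem0 (Γ ∪₁ neg C) → D0 Γ
  rep   : ∀ {Γ} → Prem0 (λ F → F ∈ Γ) → D0 Γ

mutual
  CutFree : ∀ {Γ} → D0 Γ → Set
  CutFree (axT _ _ _)         = ⊤
  CutFree (axC _ _ _)         = ⊤
  CutFree (andR _ _ _ p q)    = CutFreeP p × CutFreeP q
  CutFree (orR _ _ _ _ p)     = CutFreeP p
  CutFree (allR _ _ ps)       = ∀ n → CutFreeP (ps n)
  CutFree (exR _ _ _ p)       = CutFreeP p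
  CutFree (all2R _ _ _ _ p)   = CutFreeP p
  CutFree (cut _ _ _)         = ⊥
  CutFree (rep p)             = CutFreeP p

  CutFreeP : ∀ {P} → Prem0 P → Set
  CutFreeP (prem0 _ d _) = CutFree d

-- The index set |∀X A(X)| of the Ω-rules: pairs q = (e , Z).

record Idx (A : Fm false 0) : Set where
  constructor idx
  field
    Γe      : Sequent
    e       : D0 Γe
    e-cf    : CutFree e
    e-Pi1   : Pi1Seq Γe
    Z       : ℕ
    Z-fresh : ∀ {F} → F ∈ Γe → ¬ (F ≡ plug A Z) → ¬ Occurs Z F

Δq : ∀ {A} → Idx A → Formula → Set
Δq {A} (idx Γe _ _ _ Z _) F = F ∈ Γe × ¬ (F ≡ plug A Z)

data D : Sequent → Set

record Prem (P : Formula → Set) : Set where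
  inductive
  constructor prem
  field
    Γ'  : Sequent
    der : D Γ'
    sub : ∀ {F} → F ∈ Γ' → P F

data D where
  axT    : ∀ {Γ} (A : Formula) → TRUE A → A ∈ Γ → D Γ
  axC    : ∀ {Γ} (C : Formula) → C ∈ Γ → neg C ∈ Γ → D Γ
  andR   : ∀ {Γ} (A₀ A₁ : Formula) → (A₀ ∧' A₁) ∈ Γ →
           Prem (Γ ∪₁ A₀) → Prem (Γ ∪₁ A₁) → D Γ
  orR    : ∀ {Γ} (A₀ A₁ : Formula) (k : Fin 2) → (A₀ ∨' A₁) ∈ Γ →
           Prem (Γ ∪₁ pick k A₀ A₁) → D Γ
  allR   : ∀ {Γ} (A : Fm true 1) → all1 A ∈ Γ →
           ((n : ℕ) → Prem (Γ ∪₁ inst A n)) → D Γ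
  exR    : ∀ {Γ} (A : Fm true 1) (k : ℕ) → ex1 A ∈ Γ →
           Prem (Γ ∪₁ inst A k) → D Γ
  all2R  : ∀ {Γ} (A : Fm false 0) (Y : ℕ) → all2 A ∈ Γ → NotFreeIn Y Γ →
           Prem (Γ ∪₁ plug A Y) → D Γ
  cut    : ∀ {Γ} (C : Formula) → Prem (Γ ∪₁ C) → Prem (Γ ∪₁ neg C) → D Γ
  rep    : ∀ {Γ} → Prem (λ F → F ∈ Γ) → D Γ
  -- Ω_{¬∀XA}: principal formula ¬∀XA, premises indexed by q ∈ |∀XA(X)|
  omega  : ∀ {Γ} (A : Fm false 0) → neg (all2 A) ∈ Γ →
           ((q : Idx A) → Prem (λ F → F ∈ Γ ⊎ Δq q F)) → D Γ
  -- Ω̃^Y_{¬∀XA}: no principal formula, premise 0 with minor formula A(Y),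
  -- premises q ∈ |∀XA(X)| with minor formulas Δ_q; Y eigenvariable
  omegaT : ∀ {Γ} (A : Fm false 0) (Y : ℕ) → NotFreeIn Y Γ →
           Prem (Γ ∪₁ plug A Y) →
           ((q : Idx A) → Prem (λ F → F ∈ Γ ⊎ Δq q F)) → D Γ

Derivation : Set
Derivation = Σ Sequent D

Γof : Derivation → Sequent
Γof = proj₁

-- dg(d) ≤ m  (dg(Cut_C) = rk(C)+1, all other inference symbols 0)
mutual
  DgLe : ∀ {Γ} → ℕ → D Γ → Set
  DgLe m (axT _ _ _)         = ⊤
  DgLe m (axC _ _ _)         = ⊤
  DgLe m (andR _ _ _ p q)    = DgLeP m p × DgLeP m q
  DgLe m (orR _ _ _ _ p)     = DgLeP m p
  DgLe m (allR _ _ ps)       = ∀ n → DgLeP m (ps n)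
  DgLe m (exR _ _ _ p)       = DgLeP m p
  DgLe m (all2R _ _ _ _ p)   = DgLeP m p
  DgLe m (cut C p q)         = suc (rk C) ≤ m × DgLeP m p × DgLeP m q
  DgLe m (rep p)             = DgLeP m p
  DgLe m (omega _ _ ps)      = ∀ q → DgLeP m (ps q)
  DgLe m (omegaT _ _ _ p ps) = DgLeP m p × (∀ q → DgLeP m (ps q))

  DgLeP : ∀ {P} → ℕ → Prem P → Set
  DgLeP m (prem _ d _) = DgLe m d

_⊢[_]_ : Derivation → ℕ → Sequent → Set
d ⊢[ m ] Γ = (Γof d ≈ₛ Γ) × DgLe m (proj₂ d)

-- A cut on C of maximal degree is removed by pushing it up the (already reduced) derivation d₁
-- of ¬C until ¬C is principal there; at that point it is replaced by a cut on a minor formula of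
-- C, whose other premise comes from inverting the derivation d₀ of C. Inversion, and the push
-- itself, are instances of one transformation of derivations that replaces exactly the inferences
-- with a given principal formula. A cut on ∀X A cannot be reduced this way, as its rank is 0; it
-- becomes an Ω̃-inference instead: its premise 0 inverts d₀ at a fresh variable, and its premise q
-- collapses every Ω-inference for ¬∀X A in d₁ to its q-th premise. Where ∀X A and ¬∀X A meet in
-- an axiom, the cut-free Π¹ derivation carried by the index q is grafted in.
module Submission where

open import Defs
open import Data.Nat using (ℕ; zero; suc; _⊔_; _≤_; _<_; _+_; _∸_; s≤s)
import Data.Nat.Properties as ℕ
open import Data.Fin using (Fin; zero; suc)
import Data.Fin.Properties as Fin
open import Data.Vec using (Vec; []; _∷_)
import Data.Vec.Properties as Vec
open import Data.Bool using (true; false)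
open import Data.Unit using (⊤; tt)
open import Data.Empty using (⊥; ⊥-elim)
open import Data.Product using (Σ; _×_; _,_; proj₁; proj₂; uncurry; map₂)
open import Data.Sum using (_⊎_; inj₁; inj₂; [_,_]′)
open import Data.List using ([]; _∷_; [_]; map; filter; _++_)
open import Data.List.Relation.Unary.Any using (here; there)
open import Data.List.Membership.Propositional using (_∈_)
open import Data.List.Membership.Propositional.Properties
  using (∈-map⁺; ∈-map⁻; ∈-++⁺ˡ; ∈-++⁺ʳ; ∈-++⁻; ∈-filter⁺; ∈-filter⁻)
open import Data.List.Relation.Binary.Subset.Propositional using (_⊆_)
open import Data.List.Relation.Binary.Subset.Propositional.Properties using (∷⁺ʳ)
open import Function using (_∘_; id)
open import Relation.Binary.Definitions using (DecidableEquality)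
open import Relation.Binary.PropositionalEquality using (_≡_; _≢_; refl; sym; trans; cong; cong₂; subst)
open import Relation.Nullary using (¬_; Dec; yes; no)
open import Relation.Unary using (U; _∩_)
open import Relation.Nullary.Decidable using (map′; _×-dec_; ¬?)

tagᴾ : ∀ {k} → PR k → ℕ
tagᴾ Zero       = 0
tagᴾ Succ       = 1
tagᴾ (Proj _)   = 2
tagᴾ (Comp _ _) = 3
tagᴾ (Rec _ _)  = 4

tagᶠ : ∀ {b n} → Fm b n → ℕ
tagᶠ (rel _ _)  = 0
tagᶠ (nrel _ _) = 1
tagᶠ (mem _ _)  = 2
tagᶠ (nmem _ _) = 3
tagᶠ (_ ∧' _)   = 4
tagᶠ (_ ∨' _)   = 5
tagᶠ (all1 _)   = 6
tagᶠ (ex1 _)    = 7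
tagᶠ (all2 _)   = 8
tagᶠ (ex2 _)    = 9

-- Comparing head tags first leaves only the diagonal cases; Agda refutes the others from the tag
-- equation.
mutual
  _≟ᴾ_ : ∀ {k} → DecidableEquality (PR k)
  f ≟ᴾ g with tagᴾ f ℕ.≟ tagᴾ g
  ... | no  tags≢ = no (tags≢ ∘ cong tagᴾ)
  ... | yes tags≡ = ≟ᴾ-sameTag f g tags≡

  ≟ᴾ-sameTag : ∀ {k} (f g : PR k) → tagᴾ f ≡ tagᴾ g → Dec (f ≡ g)
  ≟ᴾ-sameTag Zero       Zero       _ = yes refl
  ≟ᴾ-sameTag Succ       Succ       _ = yes refl
  ≟ᴾ-sameTag (Proj i)   (Proj j)   _ = map′ (cong Proj) (λ { refl → refl }) (i Fin.≟ j)
  ≟ᴾ-sameTag (Comp {l = l} f fs) (Comp {l = l′} g gs) _ with l ℕ.≟ l′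
  ... | no  l≢ = no λ { refl → l≢ refl }
  ... | yes refl =
    map′ (uncurry (cong₂ Comp)) (λ { refl → refl , refl }) (f ≟ᴾ g ×-dec fs ≟ᴾs gs)
  ≟ᴾ-sameTag (Rec f h)  (Rec g k)  _ =
    map′ (uncurry (cong₂ Rec)) (λ { refl → refl , refl }) (f ≟ᴾ g ×-dec h ≟ᴾ k)

  _≟ᴾs_ : ∀ {k l} → DecidableEquality (Vec (PR k) l)
  []       ≟ᴾs []       = yes refl
  (f ∷ fs) ≟ᴾs (g ∷ gs) =
    map′ (uncurry (cong₂ _∷_)) (λ { refl → refl , refl }) (f ≟ᴾ g ×-dec fs ≟ᴾs gs)

_≟ᵗ_ : ∀ {n} → DecidableEquality (Term n)
var i ≟ᵗ var j = map′ (cong var) (λ { refl → refl }) (i Fin.≟ j)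
var _ ≟ᵗ zro   = no λ ()
var _ ≟ᵗ S _   = no λ ()
zro   ≟ᵗ var _ = no λ ()
zro   ≟ᵗ zro   = yes refl
zro   ≟ᵗ S _   = no λ ()
S _   ≟ᵗ var _ = no λ ()
S _   ≟ᵗ zro   = no λ ()
S s   ≟ᵗ S t   = map′ (cong S) (λ { refl → refl }) (s ≟ᵗ t)

_≟ˢᵃ_ : ∀ {b} → DecidableEquality (SA b)
_≟ˢᵃ_ {true}  = ℕ._≟_
_≟ˢᵃ_ {false} tt tt = yes refl

mutual
  _≟ᶠ_ : ∀ {b n} → DecidableEquality (Fm b n)
  A ≟ᶠ B with tagᶠ A ℕ.≟ tagᶠ B
  ... | no  tags≢ = no (tags≢ ∘ cong tagᶠ)
  ... | yes tags≡ = ≟ᶠ-sameTag A B tags≡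

  ≟ᶠ-sameTag : ∀ {b n} (A B : Fm b n) → tagᶠ A ≡ tagᶠ B → Dec (A ≡ B)
  ≟ᶠ-sameTag (rel {k = k} f ts) (rel {k = k′} g us) _ with k ℕ.≟ k′
  ... | no  k≢ = no λ { refl → k≢ refl }
  ... | yes refl =
    map′ (uncurry (cong₂ rel)) (λ { refl → refl , refl }) (f ≟ᴾ g ×-dec Vec.≡-dec _≟ᵗ_ ts us)
  ≟ᶠ-sameTag (nrel {k = k} f ts) (nrel {k = k′} g us) _ with k ℕ.≟ k′
  ... | no  k≢ = no λ { refl → k≢ refl }
  ... | yes refl =
    map′ (uncurry (cong₂ nrel)) (λ { refl → refl , refl }) (f ≟ᴾ g ×-dec Vec.≡-dec _≟ᵗ_ ts us)
  ≟ᶠ-sameTag (mem X s)  (mem Y t)  _ =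
    map′ (uncurry (cong₂ mem)) (λ { refl → refl , refl }) (X ≟ˢᵃ Y ×-dec s ≟ᵗ t)
  ≟ᶠ-sameTag (nmem X s) (nmem Y t) _ =
    map′ (uncurry (cong₂ nmem)) (λ { refl → refl , refl }) (X ≟ˢᵃ Y ×-dec s ≟ᵗ t)
  ≟ᶠ-sameTag (A ∧' B)   (C ∧' D)   _ =
    map′ (uncurry (cong₂ _∧'_)) (λ { refl → refl , refl }) (A ≟ᶠ C ×-dec B ≟ᶠ D)
  ≟ᶠ-sameTag (A ∨' B)   (C ∨' D)   _ =
    map′ (uncurry (cong₂ _∨'_)) (λ { refl → refl , refl }) (A ≟ᶠ C ×-dec B ≟ᶠ D)
  ≟ᶠ-sameTag (all1 A)   (all1 B)   _ = map′ (cong all1) (λ { refl → refl }) (A ≟ᶠ B)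
  ≟ᶠ-sameTag (ex1 A)    (ex1 B)    _ = map′ (cong ex1) (λ { refl → refl }) (A ≟ᶠ B)
  ≟ᶠ-sameTag (all2 A)   (all2 B)   _ = map′ (cong all2) (λ { refl → refl }) (A ≟ᶠ B)
  ≟ᶠ-sameTag (ex2 A)    (ex2 B)    _ = map′ (cong ex2) (λ { refl → refl }) (A ≟ᶠ B)

rename : ∀ {n} → (ℕ → ℕ) → Fm true n → Fm true n
rename σ (rel f ts)  = rel f ts
rename σ (nrel f ts) = nrel f ts
rename σ (mem X t)   = mem (σ X) t
rename σ (nmem X t)  = nmem (σ X) t
rename σ (A ∧' B)    = rename σ A ∧' rename σ B
rename σ (A ∨' B)    = rename σ A ∨' rename σ B
rename σ (all1 A)    = all1 (rename σ A)
rename σ (ex1 A)     = ex1 (rename σ A)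
rename σ (all2 A)    = all2 A
rename σ (ex2 A)     = ex2 A

rename-neg : ∀ {n} σ (F : Fm true n) → rename σ (neg F) ≡ neg (rename σ F)
rename-neg σ (rel f ts)  = refl
rename-neg σ (nrel f ts) = refl
rename-neg σ (mem X t)   = refl
rename-neg σ (nmem X t)  = refl
rename-neg σ (A ∧' B)    = cong₂ _∨'_ (rename-neg σ A) (rename-neg σ B)
rename-neg σ (A ∨' B)    = cong₂ _∧'_ (rename-neg σ A) (rename-neg σ B)
rename-neg σ (all1 A)    = cong ex1 (rename-neg σ A)
rename-neg σ (ex1 A)     = cong all1 (rename-neg σ A)
rename-neg σ (all2 A)    = refl
rename-neg σ (ex2 A)     = refl

rename-subF : ∀ {n m} σ (τ : Fin n → Term m) (F : Fm true n) →
              rename σ (subF τ F) ≡ subF τ (rename σ F)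
rename-subF σ τ (rel f ts)  = refl
rename-subF σ τ (nrel f ts) = refl
rename-subF σ τ (mem X t)   = refl
rename-subF σ τ (nmem X t)  = refl
rename-subF σ τ (A ∧' B)    = cong₂ _∧'_ (rename-subF σ τ A) (rename-subF σ τ B)
rename-subF σ τ (A ∨' B)    = cong₂ _∨'_ (rename-subF σ τ A) (rename-subF σ τ B)
rename-subF σ τ (all1 A)    = cong all1 (rename-subF σ (liftσ τ) A)
rename-subF σ τ (ex1 A)     = cong ex1 (rename-subF σ (liftσ τ) A)
rename-subF σ τ (all2 A)    = refl
rename-subF σ τ (ex2 A)     = refl

rename-inst : ∀ σ (A : Fm true 1) k → rename σ (inst A k) ≡ inst (rename σ A) k
rename-inst σ A k = rename-subF σ (instσ k) A

rename-plug : ∀ {n} σ (A : Fm false n) Y → rename σ (plug A Y) ≡ plug A (σ Y)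
rename-plug σ (rel f ts)  Y = refl
rename-plug σ (nrel f ts) Y = refl
rename-plug σ (mem X t)   Y = refl
rename-plug σ (nmem X t)  Y = refl
rename-plug σ (A ∧' B)    Y = cong₂ _∧'_ (rename-plug σ A Y) (rename-plug σ B Y)
rename-plug σ (A ∨' B)    Y = cong₂ _∨'_ (rename-plug σ A Y) (rename-plug σ B Y)
rename-plug σ (all1 A)    Y = cong all1 (rename-plug σ A Y)
rename-plug σ (ex1 A)     Y = cong ex1 (rename-plug σ A Y)

rename-pick : ∀ σ (k : Fin 2) (A B : Formula) →
              rename σ (pick k A B) ≡ pick k (rename σ A) (rename σ B)
rename-pick σ zero       A B = refl
rename-pick σ (suc zero) A B = refl

rk-rename : ∀ {n} σ (F : Fm true n) → rk (rename σ F) ≡ rk F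
rk-rename σ (rel f ts)  = refl
rk-rename σ (nrel f ts) = refl
rk-rename σ (mem X t)   = refl
rk-rename σ (nmem X t)  = refl
rk-rename σ (A ∧' B)    = cong₂ (λ a b → suc (a ⊔ b)) (rk-rename σ A) (rk-rename σ B)
rk-rename σ (A ∨' B)    = cong₂ (λ a b → suc (a ⊔ b)) (rk-rename σ A) (rk-rename σ B)
rk-rename σ (all1 A)    = cong suc (rk-rename σ A)
rk-rename σ (ex1 A)     = cong suc (rk-rename σ A)
rk-rename σ (all2 A)    = refl
rk-rename σ (ex2 A)     = refl

rename-cong : ∀ {n} {σ τ} (F : Fm true n) → (∀ Y → Occurs Y F → σ Y ≡ τ Y) →
              rename σ F ≡ rename τ F
rename-cong (rel f ts)  agree = refl
rename-cong (nrel f ts) agree = refl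
rename-cong (mem X t)   agree = cong (λ Y → mem Y t) (agree X refl)
rename-cong (nmem X t)  agree = cong (λ Y → nmem Y t) (agree X refl)
rename-cong (A ∧' B)    agree =
  cong₂ _∧'_ (rename-cong A (λ Y → agree Y ∘ inj₁)) (rename-cong B (λ Y → agree Y ∘ inj₂))
rename-cong (A ∨' B)    agree =
  cong₂ _∨'_ (rename-cong A (λ Y → agree Y ∘ inj₁)) (rename-cong B (λ Y → agree Y ∘ inj₂))
rename-cong (all1 A)    agree = cong all1 (rename-cong A agree)
rename-cong (ex1 A)     agree = cong ex1 (rename-cong A agree)
rename-cong (all2 A)    agree = refl
rename-cong (ex2 A)     agree = refl

rename-∘ : ∀ {n} σ ρ (F : Fm true n) → rename σ (rename ρ F) ≡ rename (σ ∘ ρ) F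
rename-∘ σ ρ (rel f ts)  = refl
rename-∘ σ ρ (nrel f ts) = refl
rename-∘ σ ρ (mem X t)   = refl
rename-∘ σ ρ (nmem X t)  = refl
rename-∘ σ ρ (A ∧' B)    = cong₂ _∧'_ (rename-∘ σ ρ A) (rename-∘ σ ρ B)
rename-∘ σ ρ (A ∨' B)    = cong₂ _∨'_ (rename-∘ σ ρ A) (rename-∘ σ ρ B)
rename-∘ σ ρ (all1 A)    = cong all1 (rename-∘ σ ρ A)
rename-∘ σ ρ (ex1 A)     = cong ex1 (rename-∘ σ ρ A)
rename-∘ σ ρ (all2 A)    = refl
rename-∘ σ ρ (ex2 A)     = refl

rename-id : ∀ {n} (F : Fm true n) → rename id F ≡ F
rename-id (rel f ts)  = refl
rename-id (nrel f ts) = refl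
rename-id (mem X t)   = refl
rename-id (nmem X t)  = refl
rename-id (A ∧' B)    = cong₂ _∧'_ (rename-id A) (rename-id B)
rename-id (A ∨' B)    = cong₂ _∨'_ (rename-id A) (rename-id B)
rename-id (all1 A)    = cong all1 (rename-id A)
rename-id (ex1 A)     = cong ex1 (rename-id A)
rename-id (all2 A)    = refl
rename-id (ex2 A)     = refl

Occurs-rename⁻ : ∀ {n} σ (F : Fm true n) {Y} → Occurs Y (rename σ F) →
                 Σ ℕ λ Z → Occurs Z F × σ Z ≡ Y
Occurs-rename⁻ σ (mem X t)  refl = X , refl , refl
Occurs-rename⁻ σ (nmem X t) refl = X , refl , refl
Occurs-rename⁻ σ (A ∧' B) (inj₁ o) = let Z , oz , e = Occurs-rename⁻ σ A o in Z , inj₁ oz , e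
Occurs-rename⁻ σ (A ∧' B) (inj₂ o) = let Z , oz , e = Occurs-rename⁻ σ B o in Z , inj₂ oz , e
Occurs-rename⁻ σ (A ∨' B) (inj₁ o) = let Z , oz , e = Occurs-rename⁻ σ A o in Z , inj₁ oz , e
Occurs-rename⁻ σ (A ∨' B) (inj₂ o) = let Z , oz , e = Occurs-rename⁻ σ B o in Z , inj₂ oz , e
Occurs-rename⁻ σ (all1 A) o = Occurs-rename⁻ σ A o
Occurs-rename⁻ σ (ex1 A)  o = Occurs-rename⁻ σ A o

TRUE⇒rename-fixed : ∀ σ {F} → TRUE F → rename σ F ≡ F
TRUE⇒rename-fixed σ {rel f ts}  _ = refl
TRUE⇒rename-fixed σ {nrel f ts} _ = refl

TRUE-rename : ∀ σ {F} → TRUE F → TRUE (rename σ F)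
TRUE-rename σ tr = subst TRUE (sym (TRUE⇒rename-fixed σ tr)) tr

Pi1-rename : ∀ {n} σ (F : Fm true n) → Pi1 F → Pi1 (rename σ F)
Pi1-rename σ (rel f ts)  p       = tt
Pi1-rename σ (nrel f ts) p       = tt
Pi1-rename σ (mem X t)   p       = tt
Pi1-rename σ (nmem X t)  p       = tt
Pi1-rename σ (A ∧' B)    (p , q) = Pi1-rename σ A p , Pi1-rename σ B q
Pi1-rename σ (A ∨' B)    (p , q) = Pi1-rename σ A p , Pi1-rename σ B q
Pi1-rename σ (all1 A)    p       = Pi1-rename σ A p
Pi1-rename σ (ex1 A)     p       = Pi1-rename σ A p
Pi1-rename σ (all2 A)    p       = p

neg-involutive : ∀ {b n} (F : Fm b n) → neg (neg F) ≡ F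
neg-involutive (rel f ts)  = refl
neg-involutive (nrel f ts) = refl
neg-involutive (mem X t)   = refl
neg-involutive (nmem X t)  = refl
neg-involutive (A ∧' B)    = cong₂ _∧'_ (neg-involutive A) (neg-involutive B)
neg-involutive (A ∨' B)    = cong₂ _∨'_ (neg-involutive A) (neg-involutive B)
neg-involutive (all1 A)    = cong all1 (neg-involutive A)
neg-involutive (ex1 A)     = cong ex1 (neg-involutive A)
neg-involutive (all2 A)    = cong all2 (neg-involutive A)
neg-involutive (ex2 A)     = cong ex2 (neg-involutive A)

neg-injective : ∀ {b n} {F G : Fm b n} → neg F ≡ neg G → F ≡ G
neg-injective {F = F} {G} e = trans (sym (neg-involutive F)) (trans (cong neg e) (neg-involutive G))

neg≢ : ∀ {b n} (F : Fm b n) → neg F ≢ F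
neg≢ (rel f ts)  ()
neg≢ (nrel f ts) ()
neg≢ (mem X t)   ()
neg≢ (nmem X t)  ()
neg≢ (A ∧' B)    ()
neg≢ (A ∨' B)    ()
neg≢ (all1 A)    ()
neg≢ (ex1 A)     ()
neg≢ (all2 A)    ()
neg≢ (ex2 A)     ()

neg-subF : ∀ {b n m} (τ : Fin n → Term m) (F : Fm b n) → neg (subF τ F) ≡ subF τ (neg F)
neg-subF τ (rel f ts)  = refl
neg-subF τ (nrel f ts) = refl
neg-subF τ (mem X t)   = refl
neg-subF τ (nmem X t)  = refl
neg-subF τ (A ∧' B)    = cong₂ _∨'_ (neg-subF τ A) (neg-subF τ B)
neg-subF τ (A ∨' B)    = cong₂ _∧'_ (neg-subF τ A) (neg-subF τ B)
neg-subF τ (all1 A)    = cong ex1 (neg-subF (liftσ τ) A)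
neg-subF τ (ex1 A)     = cong all1 (neg-subF (liftσ τ) A)
neg-subF τ (all2 A)    = cong ex2 (neg-subF τ A)
neg-subF τ (ex2 A)     = cong all2 (neg-subF τ A)

neg-inst : ∀ {b} (A : Fm b 1) k → neg (inst A k) ≡ inst (neg A) k
neg-inst A k = neg-subF (instσ k) A

neg-pick : ∀ (k : Fin 2) (A B : Formula) → neg (pick k A B) ≡ pick k (neg A) (neg B)
neg-pick zero       A B = refl
neg-pick (suc zero) A B = refl

rk-subF : ∀ {b n m} (τ : Fin n → Term m) (F : Fm b n) → rk (subF τ F) ≡ rk F
rk-subF τ (rel f ts)  = refl
rk-subF τ (nrel f ts) = refl
rk-subF τ (mem X t)   = refl
rk-subF τ (nmem X t)  = refl
rk-subF τ (A ∧' B)    = cong₂ (λ a b → suc (a ⊔ b)) (rk-subF τ A) (rk-subF τ B)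
rk-subF τ (A ∨' B)    = cong₂ (λ a b → suc (a ⊔ b)) (rk-subF τ A) (rk-subF τ B)
rk-subF τ (all1 A)    = cong suc (rk-subF (liftσ τ) A)
rk-subF τ (ex1 A)     = cong suc (rk-subF (liftσ τ) A)
rk-subF τ (all2 A)    = refl
rk-subF τ (ex2 A)     = refl

rk-neg : ∀ {b n} (F : Fm b n) → rk (neg F) ≡ rk F
rk-neg (rel f ts)  = refl
rk-neg (nrel f ts) = refl
rk-neg (mem X t)   = refl
rk-neg (nmem X t)  = refl
rk-neg (A ∧' B)    = cong₂ (λ a b → suc (a ⊔ b)) (rk-neg A) (rk-neg B)
rk-neg (A ∨' B)    = cong₂ (λ a b → suc (a ⊔ b)) (rk-neg A) (rk-neg B)
rk-neg (all1 A)    = cong suc (rk-neg A)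
rk-neg (ex1 A)     = cong suc (rk-neg A)
rk-neg (all2 A)    = refl
rk-neg (ex2 A)     = refl

rk-pick : ∀ (k : Fin 2) (A B : Formula) → rk (pick k A B) ≤ rk A ⊔ rk B
rk-pick zero       A B = ℕ.m≤m⊔n (rk A) (rk B)
rk-pick (suc zero) A B = ℕ.m≤n⊔m (rk A) (rk B)

varBound : ∀ {n} → Fm true n → ℕ
varBound (rel f ts)  = 0
varBound (nrel f ts) = 0
varBound (mem X t)   = suc X
varBound (nmem X t)  = suc X
varBound (A ∧' B)    = varBound A ⊔ varBound B
varBound (A ∨' B)    = varBound A ⊔ varBound B
varBound (all1 A)    = varBound A
varBound (ex1 A)     = varBound A
varBound (all2 A)    = 0
varBound (ex2 A)     = 0

Occurs⇒<varBound : ∀ {n} (F : Fm true n) {Y} → Occurs Y F → Y < varBound F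
Occurs⇒<varBound (mem X t)  refl = ℕ.≤-refl
Occurs⇒<varBound (nmem X t) refl = ℕ.≤-refl
Occurs⇒<varBound (A ∧' B) (inj₁ o) = ℕ.<-≤-trans (Occurs⇒<varBound A o) (ℕ.m≤m⊔n _ _)
Occurs⇒<varBound (A ∧' B) (inj₂ o) = ℕ.<-≤-trans (Occurs⇒<varBound B o) (ℕ.m≤n⊔m _ _)
Occurs⇒<varBound (A ∨' B) (inj₁ o) = ℕ.<-≤-trans (Occurs⇒<varBound A o) (ℕ.m≤m⊔n _ _)
Occurs⇒<varBound (A ∨' B) (inj₂ o) = ℕ.<-≤-trans (Occurs⇒<varBound B o) (ℕ.m≤n⊔m _ _)
Occurs⇒<varBound (all1 A) o = Occurs⇒<varBound A o
Occurs⇒<varBound (ex1 A)  o = Occurs⇒<varBound A o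

seqBound : Sequent → ℕ
seqBound []      = 0
seqBound (F ∷ Γ) = varBound F ⊔ seqBound Γ

varBound≤seqBound : ∀ {F Γ} → F ∈ Γ → varBound F ≤ seqBound Γ
varBound≤seqBound {Γ = G ∷ Γ} (here refl) = ℕ.m≤m⊔n (varBound G) (seqBound Γ)
varBound≤seqBound {Γ = G ∷ Γ} (there i)   =
  ℕ.≤-trans (varBound≤seqBound i) (ℕ.m≤n⊔m (varBound G) (seqBound Γ))

Occurs⇒<seqBound : ∀ {F Γ Y} → F ∈ Γ → Occurs Y F → Y < seqBound Γ
Occurs⇒<seqBound {F} i o = ℕ.<-≤-trans (Occurs⇒<varBound F o) (varBound≤seqBound i)

seqBound-fresh : ∀ Γ → NotFreeIn (seqBound Γ) Γ
seqBound-fresh Γ i o = ℕ.<-irrefl refl (Occurs⇒<seqBound i o)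

_[_↦_] : (ℕ → ℕ) → ℕ → ℕ → ℕ → ℕ
(σ [ W ↦ Y ]) x with x ℕ.≟ W
... | yes _ = Y
... | no  _ = σ x

[↦]-here : ∀ σ W Y → (σ [ W ↦ Y ]) W ≡ Y
[↦]-here σ W Y with W ℕ.≟ W
... | yes _  = refl
... | no W≢W = ⊥-elim (W≢W refl)

[↦]-elsewhere : ∀ σ {W Y x} → x ≢ W → (σ [ W ↦ Y ]) x ≡ σ x
[↦]-elsewhere σ {W} {x = x} x≢W with x ℕ.≟ W
... | yes x≡W = ⊥-elim (x≢W x≡W)
... | no  _   = refl

rename-[↦]-fresh : ∀ σ {W Y} (F : Formula) → ¬ Occurs W F →
                   rename (σ [ W ↦ Y ]) F ≡ rename σ F
rename-[↦]-fresh σ F W∉F = rename-cong F (λ Z o → [↦]-elsewhere σ (λ { refl → W∉F o }))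

rename-[↦]-plug : ∀ σ W Y (A : Fm false 0) → rename (σ [ W ↦ Y ]) (plug A W) ≡ plug A Y
rename-[↦]-plug σ W Y A = trans (rename-plug _ A W) (cong (plug A) ([↦]-here σ W Y))

unshift : (ℕ → ℕ) → ℕ → ℕ → ℕ
unshift σ N x with x ℕ.<? N
... | yes _ = σ x
... | no  _ = x ∸ N

unshift-< : ∀ σ N {x} → x < N → unshift σ N x ≡ σ x
unshift-< σ N {x} x<N with x ℕ.<? N
... | yes _   = refl
... | no  x≮N = ⊥-elim (x≮N x<N)

unshift-+ : ∀ σ N x → unshift σ N (x + N) ≡ x
unshift-+ σ N x with (x + N) ℕ.<? N
... | yes x+N<N = ⊥-elim (ℕ.m+n≮n x N x+N<N)
... | no  _     = ℕ.m+n∸n≡m x N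

unshift-shift : ∀ σ N (F : Formula) → rename (unshift σ N) (rename (_+ N) F) ≡ F
unshift-shift σ N F =
  trans (rename-∘ _ _ F) (trans (rename-cong F (λ Y _ → unshift-+ σ N Y)) (rename-id F))

Δlist : ∀ {A} → Idx A → Sequent
Δlist {A} q = filter (λ F → ¬? (F ≟ᶠ plug A (Idx.Z q))) (Idx.Γe q)

Δlist-sound : ∀ {A} (q : Idx A) {F} → F ∈ Δlist q → Δq q F
Δlist-sound {A} q = ∈-filter⁻ (λ F → ¬? (F ≟ᶠ plug A (Idx.Z q)))

Δlist-complete : ∀ {A} (q : Idx A) {F} → Δq q F → F ∈ Δlist q
Δlist-complete {A} q = uncurry (∈-filter⁺ (λ F → ¬? (F ≟ᶠ plug A (Idx.Z q))))

module _ (ρ : ℕ → ℕ) (ρ-injective : ∀ {x y} → ρ x ≡ ρ y → x ≡ y) where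

  NotFreeIn-rename : ∀ {Y Γ} → NotFreeIn Y Γ → NotFreeIn (ρ Y) (map (rename ρ) Γ)
  NotFreeIn-rename Y∉Γ i o with ∈-map⁻ (rename ρ) i
  ... | G , G∈Γ , refl with Occurs-rename⁻ ρ G o
  ...   | Z , oZ , ρZ≡ρY = Y∉Γ G∈Γ (subst (λ W → Occurs W G) (ρ-injective ρZ≡ρY) oZ)

  rename-∪₁ : ∀ {Γ A A′ F} → rename ρ A ≡ A′ → (Γ ∪₁ A) F →
              (map (rename ρ) Γ ∪₁ A′) (rename ρ F)
  rename-∪₁ _    (inj₁ F∈Γ) = inj₁ (∈-map⁺ (rename ρ) F∈Γ)
  rename-∪₁ refl (inj₂ refl) = inj₂ refl

  mutual
    rename-D0 : ∀ {Γ} (e : D0 Γ) → CutFree e → Σ (D0 (map (rename ρ) Γ)) CutFree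
    rename-D0 (axT A tr i) _ = axT (rename ρ A) (TRUE-rename ρ tr) (∈-map⁺ (rename ρ) i) , tt
    rename-D0 (axC C i j) _ =
      axC (rename ρ C) (∈-map⁺ (rename ρ) i)
          (subst (_∈ _) (rename-neg ρ C) (∈-map⁺ (rename ρ) j)) , tt
    rename-D0 (andR A₀ A₁ i p q) (cf-p , cf-q) =
      let p′ , cf-p′ = rename-Prem0 p cf-p (rename-∪₁ refl)
          q′ , cf-q′ = rename-Prem0 q cf-q (rename-∪₁ refl)
      in andR _ _ (∈-map⁺ (rename ρ) i) p′ q′ , cf-p′ , cf-q′
    rename-D0 (orR A₀ A₁ k i p) cf =
      let p′ , cf′ = rename-Prem0 p cf (rename-∪₁ (rename-pick ρ k A₀ A₁))
      in orR _ _ k (∈-map⁺ (rename ρ) i) p′ , cf′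
    rename-D0 (allR A i ps) cf =
      allR (rename ρ A) (∈-map⁺ (rename ρ) i) (λ n → proj₁ (premise n)) , λ n → proj₂ (premise n)
      where premise = λ n → rename-Prem0 (ps n) (cf n) (rename-∪₁ (rename-inst ρ A n))
    rename-D0 (exR A k i p) cf =
      let p′ , cf′ = rename-Prem0 p cf (rename-∪₁ (rename-inst ρ A k))
      in exR (rename ρ A) k (∈-map⁺ (rename ρ) i) p′ , cf′
    rename-D0 (all2R A Y i Y∉Γ p) cf =
      let p′ , cf′ = rename-Prem0 p cf (rename-∪₁ (rename-plug ρ A Y))
      in all2R A (ρ Y) (∈-map⁺ (rename ρ) i) (NotFreeIn-rename Y∉Γ) p′ , cf′
    rename-D0 (rep p) cf =
      let p′ , cf′ = rename-Prem0 p cf (∈-map⁺ (rename ρ)) in rep p′ , cf′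

    rename-Prem0 : ∀ {P P′ : Formula → Set} (p : Prem0 P) → CutFreeP p →
                   (∀ {F} → P F → P′ (rename ρ F)) → Σ (Prem0 P′) CutFreeP
    rename-Prem0 (prem0 Γ′ e Γ′⊆P) cf P⇒P′ =
      let e′ , cf′ = rename-D0 e cf in prem0 (map (rename ρ) Γ′) e′ sub , cf′
      where
      sub : ∀ {F} → F ∈ map (rename ρ) Γ′ → _
      sub i with ∈-map⁻ (rename ρ) i
      ... | G , G∈Γ′ , refl = P⇒P′ (Γ′⊆P G∈Γ′)

shiftIdx : ∀ {A} → ℕ → Idx A → Idx A
shiftIdx {A} N (idx Γe e cf Γe-Π¹ Z Z-fresh) =
  idx (map (rename (_+ N)) Γe) (proj₁ e′) (proj₂ e′) Π¹′ (Z + N) Z-fresh′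
  where
  +N-injective : ∀ {x y} → x + N ≡ y + N → x ≡ y
  +N-injective = ℕ.+-cancelʳ-≡ N _ _
  e′ = rename-D0 (_+ N) +N-injective e cf
  Π¹′ : Pi1Seq (map (rename (_+ N)) Γe)
  Π¹′ i with ∈-map⁻ (rename (_+ N)) i
  ... | G , G∈Γe , refl = Pi1-rename (_+ N) G (Γe-Π¹ G∈Γe)
  Z-fresh′ : ∀ {F} → F ∈ map (rename (_+ N)) Γe → F ≢ plug A (Z + N) → ¬ Occurs (Z + N) F
  Z-fresh′ i F≢ o with ∈-map⁻ (rename (_+ N)) i
  ... | G , G∈Γe , refl with Occurs-rename⁻ (_+ N) G o
  ...   | W , oW , W+N≡Z+N =
    Z-fresh G∈Γe (λ { refl → F≢ (rename-plug (_+ N) A Z) })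
      (subst (λ V → Occurs V G) (+N-injective W+N≡Z+N) oW)

mutual
  lift0 : ∀ {Γ} → D0 Γ → D Γ
  lift0 (axT A tr i)         = axT A tr i
  lift0 (axC C i j)          = axC C i j
  lift0 (andR A₀ A₁ i p q)   = andR A₀ A₁ i (lift0P p) (lift0P q)
  lift0 (orR A₀ A₁ k i p)    = orR A₀ A₁ k i (lift0P p)
  lift0 (allR A i ps)        = allR A i (lift0P ∘ ps)
  lift0 (exR A k i p)        = exR A k i (lift0P p)
  lift0 (all2R A Y i Y∉Γ p)  = all2R A Y i Y∉Γ (lift0P p)
  lift0 (cut C p q)          = cut C (lift0P p) (lift0P q)
  lift0 (rep p)              = rep (lift0P p)

  lift0P : ∀ {P} → Prem0 P → Prem P
  lift0P (prem0 Γ′ e sub) = prem Γ′ (lift0 e) sub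

mutual
  lift0-cutFree : ∀ {Γ} (e : D0 Γ) → CutFree e → ∀ m → DgLe m (lift0 e)
  lift0-cutFree (axT A tr i)        _          m = tt
  lift0-cutFree (axC C i j)         _          m = tt
  lift0-cutFree (andR A₀ A₁ i p q)  (cf-p , cf-q) m = lift0P-cutFree p cf-p m , lift0P-cutFree q cf-q m
  lift0-cutFree (orR A₀ A₁ k i p)   cf         m = lift0P-cutFree p cf m
  lift0-cutFree (allR A i ps)       cf         m = λ n → lift0P-cutFree (ps n) (cf n) m
  lift0-cutFree (exR A k i p)       cf         m = lift0P-cutFree p cf m
  lift0-cutFree (all2R A Y i Y∉Γ p) cf         m = lift0P-cutFree p cf m
  lift0-cutFree (rep p)             cf         m = lift0P-cutFree p cf m

  lift0P-cutFree : ∀ {P} (p : Prem0 P) → CutFreeP p → ∀ m → DgLeP m (lift0P p)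
  lift0P-cutFree (prem0 Γ′ e sub) = lift0-cutFree e

Bounded : (ℕ → Set) → Sequent → Set
Bounded P T = Σ (D T) λ r → ∀ m → P m → DgLe m r

Bounded-mono : ∀ {P P′ : ℕ → Set} {T} → (∀ {m} → P′ m → P m) → Bounded P T → Bounded P′ T
Bounded-mono P′⇒P (r , bound) = r , λ m → bound m ∘ P′⇒P

Extension : (ℕ → Set) → Sequent → Sequent → Set
Extension P T Ms = ∀ T′ → T ⊆ T′ → Ms ⊆ T′ → Bounded P T′

close : ∀ {P T} Ms → Extension P T Ms → Bounded P (Ms ++ T)
close Ms κ = κ _ (∈-++⁺ʳ Ms) ∈-++⁺ˡ

∈-singleton⁻ : ∀ {A F : Formula} → F ∈ [ A ] → F ≡ A
∈-singleton⁻ (here F≡A) = F≡A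

[_]⊆ : ∀ {A : Formula} {T} → A ∈ T → [ A ] ⊆ T
[ A∈T ]⊆ (here refl) = A∈T

premise : ∀ {T} Ms {Φ : Formula → Set} → (∀ {F} → F ∈ Ms → Φ F) → D (Ms ++ T) →
          Prem (λ F → F ∈ T ⊎ Φ F)
premise Ms Ms⊆Φ r = prem _ r λ i → [ inj₂ ∘ Ms⊆Φ , inj₁ ]′ (∈-++⁻ Ms i)

-- Premises are kept open over all extensions of T, so a handler may use them in a larger context.
data Step (P : ℕ → Set) (T : Sequent) : Formula → Set where
  ∧-step  : ∀ A₀ A₁ → Extension P T [ A₀ ] → Extension P T [ A₁ ] → Step P T (A₀ ∧' A₁)
  ∨-step  : ∀ A₀ A₁ k → Extension P T [ pick k A₀ A₁ ] → Step P T (A₀ ∨' A₁)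
  ∀¹-step : ∀ A → (∀ n → Extension P T [ inst A n ]) → Step P T (all1 A)
  ∃¹-step : ∀ A k → Extension P T [ inst A k ] → Step P T (ex1 A)
  ∀²-step : ∀ A → (∀ Y → Extension P T [ plug A Y ]) → Step P T (all2 A)
  Ω-step  : ∀ A {B} → neg A ≡ B → (∀ q → Extension P T (Δlist {A} q)) → Step P T (ex2 B)

rebuild : ∀ {P T H} → Step P T H → H ∈ T → Bounded P T
rebuild (∧-step A₀ A₁ κ₀ κ₁) i =
  let r₀ , b₀ = close _ κ₀
      r₁ , b₁ = close _ κ₁
  in andR A₀ A₁ i (premise _ ∈-singleton⁻ r₀) (premise _ ∈-singleton⁻ r₁) , λ m p → b₀ m p , b₁ m p
rebuild (∨-step A₀ A₁ k κ) i =
  let r , b = close _ κ in orR A₀ A₁ k i (premise _ ∈-singleton⁻ r) , b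
rebuild (∀¹-step A κ) i =
  allR A i (λ n → premise _ ∈-singleton⁻ (proj₁ (close _ (κ n)))) ,
  λ m p n → proj₂ (close _ (κ n)) m p
rebuild (∃¹-step A k κ) i =
  let r , b = close _ κ in exR A k i (premise _ ∈-singleton⁻ r) , b
rebuild {T = T} (∀²-step A κ) i =
  let r , b = close _ (κ (seqBound T))
  in all2R A (seqBound T) i (seqBound-fresh T) (premise _ ∈-singleton⁻ r) , b
rebuild (Ω-step A refl κ) i =
  omega A i (λ q → premise _ (Δlist-sound q) (proj₁ (close _ (κ q)))) ,
  λ m p q → proj₂ (close _ (κ q)) m p

Ω̃-rule : ∀ {P T} A → (∀ Y → Extension P T [ plug A Y ]) → (∀ q → Extension P T (Δlist {A} q)) →
         Bounded P T
Ω̃-rule {T = T} A κ κs =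
  let r , b = close _ (κ (seqBound T))
  in omegaT A (seqBound T) (seqBound-fresh T) (premise _ ∈-singleton⁻ r)
            (λ q → premise _ (Δlist-sound q) (proj₁ (close _ (κs q)))) ,
     λ m p → b m p , λ q → proj₂ (close _ (κs q)) m p

cut-rule : ∀ {P T} C → (∀ {m} → P m → suc (rk C) ≤ m) →
           Bounded P (C ∷ T) → Bounded P (neg C ∷ T) → Bounded P T
cut-rule C rk<m (r₀ , b₀) (r₁ , b₁) =
  cut C (premise _ ∈-singleton⁻ r₀) (premise _ ∈-singleton⁻ r₁) , λ m p → rk<m p , b₀ m p , b₁ m p

Maps : Formula → (ℕ → ℕ) → (Formula → Set) → Sequent → Set
Maps G σ Φ T = ∀ {F} → Φ F → rename σ F ∈ G ∷ T

record Handlers (G : Formula) (Q : ℕ → Set) (T₀ : Sequent) : Set₁ where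
  field
    onTrue : ∀ {Pre T} → T₀ ⊆ T → TRUE G → Bounded (Q ∩ Pre) T
    onDual : ∀ {Pre T} → T₀ ⊆ T → neg G ∈ T → Bounded (Q ∩ Pre) T
    onRule : ∀ {Pre T} → T₀ ⊆ T → Step (Q ∩ Pre) T G → Bounded (Q ∩ Pre) T

-- Transforms a derivation of Γ ⊆ G ∷ T into one of T, leaving every inference in place except those
-- with principal formula G, which the handlers replace. The set-variable renaming σ keeps the
-- eigenvariables of the copied inferences fresh for the new end-sequents.
module Traverse {G Q T₀} (handlers : Handlers G Q T₀) where
  open Handlers handlers

  axiom : ∀ {Pre T C} → T₀ ⊆ T → C ∈ G ∷ T → neg C ∈ G ∷ T → Bounded (Q ∩ Pre) T
  axiom T₀⊆T (here refl) (here ¬G≡G) = ⊥-elim (neg≢ G ¬G≡G)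
  axiom T₀⊆T (here refl) (there j)   = onDual T₀⊆T j
  axiom {T = T} {C} T₀⊆T (there i) (here ¬C≡G) =
    onDual T₀⊆T (subst (_∈ T) (trans (sym (neg-involutive C)) (cong neg ¬C≡G)) i)
  axiom T₀⊆T (there i) (there j) = axC _ i j , _

  principal : ∀ {Pre T H} → T₀ ⊆ T → H ∈ G ∷ T → Step (Q ∩ Pre) T H → Bounded (Q ∩ Pre) T
  principal T₀⊆T (here refl) step = onRule T₀⊆T step
  principal T₀⊆T (there i)   step = rebuild step i

  extend : ∀ {σ Γ T T′ A} → Maps G σ (_∈ Γ) T → T ⊆ T′ → rename σ A ∈ T′ → Maps G σ (Γ ∪₁ A) T′
  extend h T⊆T′ A∈T′ (inj₁ F∈Γ)  = ∷⁺ʳ G T⊆T′ (h F∈Γ)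
  extend h T⊆T′ A∈T′ (inj₂ refl) = there A∈T′

  extend-eigen : ∀ {σ Γ T T′ W Y A} → Maps G σ (_∈ Γ) T → NotFreeIn W Γ → T ⊆ T′ → plug A Y ∈ T′ →
                 Maps G (σ [ W ↦ Y ]) (Γ ∪₁ plug A W) T′
  extend-eigen {σ} h W∉Γ T⊆T′ A∈T′ {F} (inj₁ F∈Γ) =
    subst (_∈ _) (sym (rename-[↦]-fresh σ F (W∉Γ F∈Γ))) (∷⁺ʳ G T⊆T′ (h F∈Γ))
  extend-eigen {σ} {W = W} {Y} {A} h W∉Γ T⊆T′ A∈T′ (inj₂ refl) =
    there (subst (_∈ _) (sym (rename-[↦]-plug σ W Y A)) A∈T′)

  -- The q-th premise is read off the premise indexed by q shifted past the variables of Γ, so that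
  -- a single renaming can act as σ on Γ and undo the shift on Δ_q.
  extend-Ω : ∀ {σ Γ T T′ A} (q : Idx A) → Maps G σ (_∈ Γ) T → T ⊆ T′ → Δlist q ⊆ T′ →
             Maps G (unshift σ (seqBound Γ)) (λ F → F ∈ Γ ⊎ Δq (shiftIdx (seqBound Γ) q) F) T′
  extend-Ω {σ} {Γ} q h T⊆T′ Δ⊆T′ {F} (inj₁ F∈Γ) =
    subst (_∈ _) (sym (rename-cong F (λ Y o → unshift-< σ (seqBound Γ) (Occurs⇒<seqBound F∈Γ o))))
      (∷⁺ʳ G T⊆T′ (h F∈Γ))
  extend-Ω {σ} {Γ} {A = A} q h T⊆T′ Δ⊆T′ (inj₂ (i , F≢)) with ∈-map⁻ (rename (_+ seqBound Γ)) i
  ... | F , F∈Γe , refl =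
    there (subst (_∈ _) (sym (unshift-shift σ (seqBound Γ) F))
      (Δ⊆T′ (Δlist-complete q (F∈Γe , λ { refl → F≢ (rename-plug _ A (Idx.Z q)) }))))

  mutual
    traverse : ∀ {Γ T} (d : D Γ) σ → T₀ ⊆ T → Maps G σ (_∈ Γ) T → Bounded (Q ∩ (λ m → DgLe m d)) T
    traverse (axT A tr i) σ T₀⊆T h with h i
    ... | here A≡G = onTrue T₀⊆T (subst TRUE A≡G (TRUE-rename σ tr))
    ... | there j  = axT _ (TRUE-rename σ tr) j , _
    traverse (axC C i j) σ T₀⊆T h = axiom T₀⊆T (h i) (subst (_∈ _) (rename-neg σ C) (h j))
    traverse (andR A₀ A₁ i p q) σ T₀⊆T h =
      principal T₀⊆T (h i) (∧-step _ _ (minor p proj₁ σ refl T₀⊆T h) (minor q proj₂ σ refl T₀⊆T h))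
    traverse (orR A₀ A₁ k i p) σ T₀⊆T h =
      principal T₀⊆T (h i) (∨-step _ _ k (minor p id σ (rename-pick σ k A₀ A₁) T₀⊆T h))
    traverse (allR A i ps) σ T₀⊆T h =
      principal T₀⊆T (h i) (∀¹-step _ λ n → minor (ps n) (λ dg → dg n) σ (rename-inst σ A n) T₀⊆T h)
    traverse (exR A k i p) σ T₀⊆T h =
      principal T₀⊆T (h i) (∃¹-step _ k (minor p id σ (rename-inst σ A k) T₀⊆T h))
    traverse (all2R A W i W∉Γ p) σ T₀⊆T h =
      principal T₀⊆T (h i) (∀²-step A (eigenMinor p id W∉Γ σ T₀⊆T h))
    traverse (cut C p q) σ T₀⊆T h =
      cut-rule (rename σ C) (λ (_ , rk<m , _) → subst (λ r → suc r ≤ _) (sym (rk-rename σ C)) rk<m)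
        (close _ (minor p (proj₁ ∘ proj₂) σ refl T₀⊆T h))
        (close _ (minor q (proj₂ ∘ proj₂) σ (rename-neg σ C) T₀⊆T h))
    traverse (rep p) σ T₀⊆T h = traverseP p σ T₀⊆T h
    traverse {Γ} (omega A i ps) σ T₀⊆T h =
      principal T₀⊆T (h i) (Ω-step A refl λ q →
        ΩMinor q (ps (shiftIdx (seqBound Γ) q)) (λ dg → dg (shiftIdx (seqBound Γ) q)) σ T₀⊆T h)
    traverse {Γ} (omegaT A W W∉Γ p ps) σ T₀⊆T h =
      Ω̃-rule A (eigenMinor p proj₁ W∉Γ σ T₀⊆T h) λ q →
        ΩMinor q (ps (shiftIdx (seqBound Γ) q)) (λ dg → proj₂ dg (shiftIdx (seqBound Γ) q)) σ T₀⊆T h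

    traverseP : ∀ {P T} (p : Prem P) σ → T₀ ⊆ T → Maps G σ P T → Bounded (Q ∩ (λ m → DgLeP m p)) T
    traverseP (prem Γ′ d sub) σ T₀⊆T h = traverse d σ T₀⊆T (h ∘ sub)

    minor : ∀ {Γ T A A′} {Pre : ℕ → Set} (p : Prem (Γ ∪₁ A)) → (∀ {m} → Pre m → DgLeP m p) →
            ∀ σ → rename σ A ≡ A′ → T₀ ⊆ T → Maps G σ (_∈ Γ) T → Extension (Q ∩ Pre) T [ A′ ]
    minor p sel σ refl T₀⊆T h T′ T⊆T′ A⊆T′ =
      Bounded-mono (map₂ sel) (traverseP p σ (T⊆T′ ∘ T₀⊆T) (extend h T⊆T′ (A⊆T′ (here refl))))

    eigenMinor : ∀ {Γ T A W} {Pre : ℕ → Set} (p : Prem (Γ ∪₁ plug A W)) → (∀ {m} → Pre m → DgLeP m p) →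
                 NotFreeIn W Γ → ∀ σ → T₀ ⊆ T → Maps G σ (_∈ Γ) T →
                 ∀ Y → Extension (Q ∩ Pre) T [ plug A Y ]
    eigenMinor {W = W} p sel W∉Γ σ T₀⊆T h Y T′ T⊆T′ A⊆T′ =
      Bounded-mono (map₂ sel)
        (traverseP p (σ [ W ↦ Y ]) (T⊆T′ ∘ T₀⊆T) (extend-eigen h W∉Γ T⊆T′ (A⊆T′ (here refl))))

    ΩMinor : ∀ {Γ T A} {Pre : ℕ → Set} (q : Idx A)
             (p : Prem (λ F → F ∈ Γ ⊎ Δq (shiftIdx (seqBound Γ) q) F)) →
             (∀ {m} → Pre m → DgLeP m p) → ∀ σ → T₀ ⊆ T → Maps G σ (_∈ Γ) T →
             Extension (Q ∩ Pre) T (Δlist q)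
    ΩMinor {Γ} q p sel σ T₀⊆T h T′ T⊆T′ Δ⊆T′ =
      Bounded-mono (map₂ sel)
        (traverseP p (unshift σ (seqBound Γ)) (T⊆T′ ∘ T₀⊆T) (extend-Ω q h T⊆T′ Δ⊆T′))

  run : ∀ {Γ T} (d : D Γ) → T₀ ⊆ T → Γ ⊆ G ∷ T → Bounded (Q ∩ (λ m → DgLe m d)) T
  run d T₀⊆T Γ⊆ = traverse d id T₀⊆T λ {F} F∈Γ → subst (_∈ _) (sym (rename-id F)) (Γ⊆ F∈Γ)

invert : ∀ {G T₀ Γ T} → Handlers G U T₀ → (d : D Γ) → Γ ⊆ G ∷ T → T₀ ⊆ T → Bounded (λ m → DgLe m d) T
invert handlers d Γ⊆ T₀⊆T = Bounded-mono (tt ,_) (Traverse.run handlers d T₀⊆T Γ⊆)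

absorbing : ∀ G → Handlers G U [ G ]
absorbing G = record
  { onTrue = λ G⊆T tr → axT G tr (G⊆T (here refl)) , _
  ; onDual = λ G⊆T j → axC G (G⊆T (here refl)) j , _
  ; onRule = λ G⊆T step → rebuild step (G⊆T (here refl))
  }

embedIdx : ∀ {A T} (q : Idx A) Y → plug A Y ∈ T → Δlist q ⊆ T → Bounded U T
embedIdx {A} {T} q@(idx Γe e cf _ Z Z-fresh) Y A∈T Δ⊆T =
  Bounded-mono (λ {m} _ → tt , lift0-cutFree e cf m)
    (Traverse.traverse (absorbing (plug A Y)) (lift0 e) (id [ Z ↦ Y ]) [ A∈T ]⊆ maps)
  where
  maps : Maps (plug A Y) (id [ Z ↦ Y ]) (_∈ Γe) T
  maps {F} F∈Γe with F ≟ᶠ plug A Z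
  ... | yes refl = here (rename-[↦]-plug id Z Y A)
  ... | no  F≢   =
    there (subst (_∈ T) (sym (trans (rename-[↦]-fresh id F (Z-fresh F∈Γe F≢)) (rename-id F)))
                 (Δ⊆T (Δlist-complete q (F∈Γe , F≢))))

select : ∀ {P T A₀ A₁} k → Extension P T [ A₀ ] → Extension P T [ A₁ ] → Extension P T [ pick k A₀ A₁ ]
select zero       κ₀ κ₁ = κ₀
select (suc zero) κ₀ κ₁ = κ₁

∧-inversion : ∀ A₀ A₁ k → Handlers (A₀ ∧' A₁) U [ pick k A₀ A₁ ]
∧-inversion A₀ A₁ k = record
  { onTrue = λ _ ()
  ; onDual = λ Aₖ⊆T j → orR (neg A₀) (neg A₁) k j (premise _ ∈-singleton⁻
               (axC (pick k A₀ A₁) (there (Aₖ⊆T (here refl))) (here (neg-pick k A₀ A₁)))) , _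
  ; onRule = λ { Aₖ⊆T (∧-step _ _ κ₀ κ₁) → select k κ₀ κ₁ _ id Aₖ⊆T }
  }

∀¹-inversion : ∀ A n → Handlers (all1 A) U [ inst A n ]
∀¹-inversion A n = record
  { onTrue = λ _ ()
  ; onDual = λ An⊆T j → exR (neg A) n j (premise _ ∈-singleton⁻
               (axC (inst A n) (there (An⊆T (here refl))) (here (neg-inst A n)))) , _
  ; onRule = λ { An⊆T (∀¹-step _ κ) → κ n _ id An⊆T }
  }

∀²-inversion : ∀ A Y → Handlers (all2 A) U [ plug A Y ]
∀²-inversion A Y = record
  { onTrue = λ _ ()
  ; onDual = λ AY⊆T j → rebuild (Ω-step A refl λ q T′ T⊆T′ Δ⊆T′ →
               Bounded-mono _ (embedIdx q Y (T⊆T′ (AY⊆T (here refl))) Δ⊆T′)) j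
  ; onRule = λ { AY⊆T (∀²-step _ κ) → κ Y _ id AY⊆T }
  }

Ω-collapse : ∀ A (q : Idx A) → Handlers (ex2 (neg A)) U (Δlist q)
Ω-collapse A q = record
  { onTrue = λ _ ()
  ; onDual = λ {_} {T} Δ⊆T j → rebuild (∀²-step A λ W T′ T⊆T′ AW⊆T′ →
               Bounded-mono _ (embedIdx q W (AW⊆T′ (here refl)) (T⊆T′ ∘ Δ⊆T)))
               (subst (λ B → all2 B ∈ T) (neg-involutive A) j)
  ; onRule = onRule
  }
  where
  onRule : ∀ {P T} → Δlist q ⊆ T → Step P T (ex2 (neg A)) → Bounded P T
  onRule Δ⊆T (Ω-step A′ ¬A′≡¬A κ) with neg-injective ¬A′≡¬A
  ... | refl = κ q _ id Δ⊆T

Literal : Formula → Set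
Literal (rel _ _)  = ⊤
Literal (nrel _ _) = ⊤
Literal (mem _ _)  = ⊤
Literal (nmem _ _) = ⊤
Literal _          = ⊥

Literal-neg : ∀ C → Literal C → Literal (neg C)
Literal-neg (rel _ _)  _ = tt
Literal-neg (nrel _ _) _ = tt
Literal-neg (mem _ _)  _ = tt
Literal-neg (nmem _ _) _ = tt

Step-¬Literal : ∀ {P T H} → Step P T H → ¬ Literal H
Step-¬Literal (∧-step _ _ _ _) ()
Step-¬Literal (∨-step _ _ _ _) ()
Step-¬Literal (∀¹-step _ _)    ()
Step-¬Literal (∃¹-step _ _ _)  ()
Step-¬Literal (∀²-step _ _)    ()
Step-¬Literal (Ω-step _ _ _)   ()

TRUE⇒¬TRUE-neg : ∀ {C} → TRUE C → ¬ TRUE (neg C)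
TRUE⇒¬TRUE-neg {rel _ _}  holds fails = fails holds
TRUE⇒¬TRUE-neg {nrel _ _} fails holds = fails holds

falsify : ∀ C → Literal C → TRUE (neg C) → Handlers C U []
falsify C lit ¬C-true = record
  { onTrue = λ _ C-true → ⊥-elim (TRUE⇒¬TRUE-neg C-true ¬C-true)
  ; onDual = λ _ j → axT (neg C) ¬C-true j , _
  ; onRule = λ _ step → ⊥-elim (Step-¬Literal step lit)
  }

CutBound : ∀ {Γ₀ Γ₁} → Formula → D Γ₀ → D Γ₁ → ℕ → Set
CutBound C d₀ d₁ = (λ m → rk C ≤ m × DgLe m d₀) ∩ (λ m → DgLe m d₁)

Reducer : Formula → Set
Reducer C = ∀ {Γ₀ Γ₁ T} (d₀ : D Γ₀) (d₁ : D Γ₁) → Γ₀ ⊆ C ∷ T → Γ₁ ⊆ neg C ∷ T →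
            Bounded (CutBound C d₀ d₁) T

Reducer-dual : ∀ C → Reducer (neg C) → Reducer C
Reducer-dual C reduce-¬C {Γ₀} {T = T} d₀ d₁ Γ₀⊆ Γ₁⊆ =
  Bounded-mono swap (reduce-¬C d₁ d₀ Γ₁⊆ (subst (λ C′ → Γ₀ ⊆ C′ ∷ T) (sym (neg-involutive C)) Γ₀⊆))
  where
  swap : ∀ {m} → CutBound C d₀ d₁ m → CutBound (neg C) d₁ d₀ m
  swap ((rk≤ , dg₀) , dg₁) = (subst (_≤ _) (sym (rk-neg C)) rk≤ , dg₁) , dg₀

module Reduction (C : Formula) {Γ₀ Γ₁ T} (d₀ : D Γ₀) (d₁ : D Γ₁) (Γ₀⊆ : Γ₀ ⊆ C ∷ T)
                 (Γ₁⊆ : Γ₁ ⊆ neg C ∷ T) where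
  Q : ℕ → Set
  Q m = rk C ≤ m × DgLe m d₀

  lift-d₀ : ∀ {T′} → T ⊆ T′ → Γ₀ ⊆ C ∷ T′
  lift-d₀ T⊆T′ = ∷⁺ʳ C T⊆T′ ∘ Γ₀⊆

  reduceWith : (∀ {T′} → T ⊆ T′ → TRUE (neg C) → Bounded (λ m → DgLe m d₀) T′) →
               (∀ {Pre T′} → T ⊆ T′ → Step (Q ∩ Pre) T′ (neg C) → Bounded (Q ∩ Pre) T′) →
               Bounded (CutBound C d₀ d₁) T
  reduceWith onTrue onRule = Traverse.run handlers d₁ id Γ₁⊆
    where
    handlers : Handlers (neg C) Q T
    handlers = record
      { onTrue = λ T⊆T′ tr → Bounded-mono (proj₂ ∘ proj₁) (onTrue T⊆T′ tr)
      ; onDual = λ {_} {T′} T⊆T′ j → Bounded-mono (proj₂ ∘ proj₁)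
                   (invert (absorbing C) d₀ (lift-d₀ T⊆T′) [ subst (_∈ T′) (neg-involutive C) j ]⊆)
      ; onRule = onRule
      }

reduce-literal : ∀ C → Literal C → Reducer C
reduce-literal C lit d₀ d₁ Γ₀⊆ Γ₁⊆ = reduceWith
  (λ T⊆T′ ¬C-true → invert (falsify C lit ¬C-true) d₀ (lift-d₀ T⊆T′) (λ ()))
  (λ _ step → ⊥-elim (Step-¬Literal step (Literal-neg C lit)))
  where open Reduction C d₀ d₁ Γ₀⊆ Γ₁⊆

reduce-∧ : ∀ A₀ A₁ → Reducer (A₀ ∧' A₁)
reduce-∧ A₀ A₁ d₀ d₁ Γ₀⊆ Γ₁⊆ = reduceWith (λ _ ()) onRule
  where
  open Reduction (A₀ ∧' A₁) d₀ d₁ Γ₀⊆ Γ₁⊆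
  onRule : ∀ {Pre T′} → _ ⊆ T′ → Step (Q ∩ Pre) T′ (neg (A₀ ∧' A₁)) → Bounded (Q ∩ Pre) T′
  onRule T⊆T′ (∨-step _ _ k κ) =
    cut-rule (pick k A₀ A₁) (λ ((rk≤ , _) , _) → ℕ.≤-trans (s≤s (rk-pick k A₀ A₁)) rk≤)
      (Bounded-mono (proj₂ ∘ proj₁)
        (invert (∧-inversion A₀ A₁ k) d₀ (lift-d₀ (there ∘ T⊆T′)) [ here refl ]⊆))
      (κ _ there [ here (sym (neg-pick k A₀ A₁)) ]⊆)

reduce-∀¹ : ∀ A → Reducer (all1 A)
reduce-∀¹ A d₀ d₁ Γ₀⊆ Γ₁⊆ = reduceWith (λ _ ()) onRule
  where
  open Reduction (all1 A) d₀ d₁ Γ₀⊆ Γ₁⊆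
  onRule : ∀ {Pre T′} → _ ⊆ T′ → Step (Q ∩ Pre) T′ (neg (all1 A)) → Bounded (Q ∩ Pre) T′
  onRule T⊆T′ (∃¹-step _ k κ) =
    cut-rule (inst A k) (λ ((rk≤ , _) , _) → subst (λ r → suc r ≤ _) (sym (rk-subF (instσ k) A)) rk≤)
      (Bounded-mono (proj₂ ∘ proj₁)
        (invert (∀¹-inversion A k) d₀ (lift-d₀ (there ∘ T⊆T′)) [ here refl ]⊆))
      (κ _ there [ here (sym (neg-inst A k)) ]⊆)

reduce-∀² : ∀ A → Reducer (all2 A)
reduce-∀² A d₀ d₁ Γ₀⊆ Γ₁⊆ = Ω̃-rule A
  (λ Y T′ T⊆T′ AY⊆T′ → Bounded-mono (proj₂ ∘ proj₁)
     (invert (∀²-inversion A Y) d₀ (∷⁺ʳ _ T⊆T′ ∘ Γ₀⊆) AY⊆T′))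
  (λ q T′ T⊆T′ Δ⊆T′ → Bounded-mono proj₂ (invert (Ω-collapse A q) d₁ (∷⁺ʳ _ T⊆T′ ∘ Γ₁⊆) Δ⊆T′))

reduce : ∀ C → Reducer C
reduce (rel f ts)  = reduce-literal (rel f ts) tt
reduce (nrel f ts) = reduce-literal (nrel f ts) tt
reduce (mem X t)   = reduce-literal (mem X t) tt
reduce (nmem X t)  = reduce-literal (nmem X t) tt
reduce (A₀ ∧' A₁)  = reduce-∧ A₀ A₁
reduce (A₀ ∨' A₁)  = Reducer-dual (A₀ ∨' A₁) (reduce-∧ (neg A₀) (neg A₁))
reduce (all1 A)    = reduce-∀¹ A
reduce (ex1 A)     = Reducer-dual (ex1 A) (reduce-∀¹ (neg A))
reduce (all2 A)    = reduce-∀² A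
reduce (ex2 A)     = Reducer-dual (ex2 A) (reduce-∀² (neg A))

∪₁⇒∷ : ∀ {Γ C F} → (Γ ∪₁ C) F → F ∈ C ∷ Γ
∪₁⇒∷ (inj₁ F∈Γ) = there F∈Γ
∪₁⇒∷ (inj₂ F≡C) = here F≡C

mutual
  eliminate : ∀ {Γ} (d : D Γ) → Bounded (λ m → DgLe (suc m) d) Γ
  eliminate (axT A tr i) = axT A tr i , _
  eliminate (axC C i j) = axC C i j , _
  eliminate (andR A₀ A₁ i p q) =
    let p′ , bp = eliminateP p
        q′ , bq = eliminateP q
    in andR A₀ A₁ i p′ q′ , λ m (dp , dq) → bp m dp , bq m dq
  eliminate (orR A₀ A₁ k i p) = let p′ , bp = eliminateP p in orR A₀ A₁ k i p′ , bp
  eliminate (allR A i ps) =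
    allR A i (proj₁ ∘ eliminateP ∘ ps) , λ m dps n → proj₂ (eliminateP (ps n)) m (dps n)
  eliminate (exR A k i p) = let p′ , bp = eliminateP p in exR A k i p′ , bp
  eliminate (all2R A Y i Y∉Γ p) = let p′ , bp = eliminateP p in all2R A Y i Y∉Γ p′ , bp
  eliminate (cut C (prem Γ₀ d₀ sub₀) (prem Γ₁ d₁ sub₁)) =
    let r₀ , b₀ = eliminate d₀
        r₁ , b₁ = eliminate d₁
    in Bounded-mono (λ { (s≤s rk≤ , dg₀ , dg₁) → (rk≤ , b₀ _ dg₀) , b₁ _ dg₁ })
         (reduce C r₀ r₁ (∪₁⇒∷ ∘ sub₀) (∪₁⇒∷ ∘ sub₁))
  eliminate (rep p) = let p′ , bp = eliminateP p in rep p′ , bp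
  eliminate (omega A i ps) =
    omega A i (proj₁ ∘ eliminateP ∘ ps) , λ m dps q → proj₂ (eliminateP (ps q)) m (dps q)
  eliminate (omegaT A Y Y∉Γ p ps) =
    let p′ , bp = eliminateP p
    in omegaT A Y Y∉Γ p′ (proj₁ ∘ eliminateP ∘ ps) ,
       λ m (dp , dps) → bp m dp , λ q → proj₂ (eliminateP (ps q)) m (dps q)

  eliminateP : ∀ {P} (p : Prem P) → Σ (Prem P) λ p′ → ∀ m → DgLeP (suc m) p → DgLeP m p′
  eliminateP (prem Γ′ d sub) = let r , b = eliminate d in prem Γ′ r sub , b

theorem2 : Σ (Derivation → Derivation) (λ E → (d : Derivation) → ((m : ℕ) (Γ : Sequent) → d ⊢[ suc m ] Γ → E d ⊢[ m ] Γ) × (Γof (E d) ≈ₛ Γof d))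
theorem2 =
  (λ (Γ , d) → Γ , proj₁ (eliminate d)) ,
  λ (Γ , d) → (λ m Δ (Γ≈Δ , dg) → Γ≈Δ , proj₂ (eliminate d) m dg) , id , id
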